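{- For every graph $G$ and every vertex $x$ of $G$, there exists a Grundy dominating sequence of $G$ that contains $x$.
   Context: For a vertex $v$, $N[v]$ is its closed neighborhood. A closed neighborhood sequence of $G$ is a sequence $(v_1,\ldots,v_k)$ of distinct vertices such that for each $i\in[k]$, $N[v_i]\setminus\bigcup_{j=1}^{i-1}N[v_j]\neq\emptyset$. A Grundy dominating sequence is a closed neighborhood sequence of maximum length. -}

module Defs where

open import Data.Nat using (ℕ; _≤_)
open import Data.Fin using (Fin)
open import Data.List using (List; []; _∷_; length; _∷ʳ_)
open import Data.List.Relation.Unary.Unique.Propositional using (Unique)
open import Data.List.Relation.Unary.All using (All)
open import Data.List.Membership.Propositional using (_∈_)
open import Data.Product using (Σ; _×_; ∃)
open import Data.Sum using (_⊎_)
open import Relation.Nullary using (¬_)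
open import Relation.Binary.PropositionalEquality using (_≡_)
open import Relation.Binary using (Decidable; Symmetric; Irreflexive)

record Graph (n : ℕ) : Set₁ where
  field
    Adj   : Fin n → Fin n → Set
    adj?  : Decidable Adj
    sym   : Symmetric Adj
    irrefl : Irreflexive _≡_ Adj

module _ {n : ℕ} (G : Graph n) where
  open Graph G

  InClosedNbhd : Fin n → Fin n → Set
  InClosedNbhd u v = u ≡ v ⊎ Adj v u

  Dominated : Fin n → List (Fin n) → Set
  Dominated u ws = Σ (Fin n) λ w → w ∈ ws × InClosedNbhd u w

  -- Every vertex v of the sequence has a vertex of N[v] not in N[w] for all
  -- earlier w.  `ClosedNbhdSeqFrom prev vs` checks vs given prefix prev.
  data ClosedNbhdSeqFrom : List (Fin n) → List (Fin n) → Set where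
    []  : ∀ {prev} → ClosedNbhdSeqFrom prev []
    _∷_ : ∀ {prev v vs} →
          (Σ (Fin n) λ u → InClosedNbhd u v × ¬ Dominated u prev) →
          ClosedNbhdSeqFrom (prev ∷ʳ v) vs →
          ClosedNbhdSeqFrom prev (v ∷ vs)

  IsClosedNbhdSeq : List (Fin n) → Set
  IsClosedNbhdSeq vs = Unique vs × ClosedNbhdSeqFrom [] vs

  IsGrundyDominatingSeq : List (Fin n) → Set
  IsGrundyDominatingSeq vs =
    IsClosedNbhdSeq vs × (∀ ws → IsClosedNbhdSeq ws → length ws ≤ length vs)

-- Among all closed neighbourhood sequences of maximum length take any one, S.
-- If x is not in S, go through S from the back: as long as no footprint met so
-- far lies in N[x], the suffix stays a closed neighbourhood sequence even after
-- x is added to the prefix. At the first (rightmost) vertex whose footprint lies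
-- in N[x], replace that vertex by x; this keeps the length. If there is no such
-- vertex, x followed by S is a longer sequence, contradicting maximality.
module Submission where

open import Defs
open import Data.Nat using (ℕ; zero; suc; pred; _≤_; s≤s)
open import Data.Nat.Properties using (≤-pred; m≤n⇒m<n∨m≡n; <-irrefl; ≰⇒>; _≤?_)
open import Data.Fin using (Fin; _≟_)
import Data.Fin as Fin
open import Data.Fin.Properties using (any?; pigeonhole)
open import Data.List using (List; []; _∷_; length; _∷ʳ_; lookup)
open import Data.List.Membership.Propositional using (_∈_; _∉_; find; lose)
open import Data.List.Membership.Propositional.Properties using (∈-lookup; ∈-++⁺ˡ; ∈-++⁺ʳ; ∈-++⁻)
open import Data.List.Relation.Binary.Subset.Propositional using (_⊆_)
open import Data.List.Relation.Unary.Any using (here; there)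
import Data.List.Relation.Unary.Any as Any
open import Data.List.Relation.Unary.All using (All; []; _∷_)
import Data.List.Relation.Unary.All as All
open import Data.List.Relation.Unary.AllPairs using ([]; _∷_)
open import Data.List.Relation.Unary.Unique.Propositional using (Unique)
open import Data.Product using (Σ; _×_; _,_)
open import Data.Sum using (_⊎_; inj₁; inj₂)
open import Data.Empty using (⊥-elim)
open import Relation.Nullary using (¬_; Dec; yes; no)
open import Relation.Nullary.Decidable using (_×-dec_; _⊎-dec_; ¬?; map′)
open import Relation.Unary using (Pred; Decidable)
open import Relation.Binary.PropositionalEquality using (_≡_; _≢_; refl; sym; cong; subst)

Unique⇒lookup-injective : ∀ {a} {A : Set a} {xs : List A} → Unique xs →
  ∀ {i j} → i Fin.< j → lookup xs i ≢ lookup xs j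
Unique⇒lookup-injective (x∉xs ∷ _) {Fin.zero} {Fin.suc j} _ = All.lookup x∉xs (∈-lookup j)
Unique⇒lookup-injective (_ ∷ uniq) {Fin.suc i} {Fin.suc j} (s≤s i<j) =
  Unique⇒lookup-injective uniq i<j

Unique⇒length≤ : ∀ {n} {xs : List (Fin n)} → Unique xs → length xs ≤ n
Unique⇒length≤ {n} {xs} uniq with length xs ≤? n
... | yes length≤n = length≤n
... | no length≰n with pigeonhole (≰⇒> length≰n) (lookup xs)
...   | i , j , i<j , eq = ⊥-elim (Unique⇒lookup-injective uniq i<j eq)

maximum-below : ∀ {p} {P : Pred ℕ p} → Decidable P → P 0 →
  ∀ m → Σ ℕ λ k → P k × (∀ j → j ≤ m → P j → j ≤ k)
maximum-below P? P0 zero = zero , P0 , λ _ j≤0 _ → j≤0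
maximum-below {P = P} P? P0 (suc m) with P? (suc m)
... | yes Pm+1 = suc m , Pm+1 , λ _ j≤m+1 _ → j≤m+1
... | no ¬Pm+1 with maximum-below P? P0 m
...   | k , Pk , max = k , Pk , max′
  where
  max′ : ∀ j → j ≤ suc m → P j → j ≤ k
  max′ j j≤m+1 Pj with m≤n⇒m<n∨m≡n j≤m+1
  ... | inj₁ j<m+1 = max j (≤-pred j<m+1) Pj
  ... | inj₂ refl = ⊥-elim (¬Pm+1 Pj)

maximum : ∀ {p} {P : Pred ℕ p} → Decidable P → P 0 → ∀ m → (∀ j → P j → j ≤ m) →
  Σ ℕ λ k → P k × (∀ j → P j → j ≤ k)
maximum P? P0 m bound with maximum-below P? P0 m
... | k , Pk , max = k , Pk , λ j Pj → max j (bound j Pj) Pj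

module _ {n : ℕ} (G : Graph n) where
  open Graph G using (adj?)

  inClosedNbhd? : ∀ u v → Dec (InClosedNbhd G u v)
  inClosedNbhd? u v = (u ≟ v) ⊎-dec adj? v u

  dominated? : ∀ u ws → Dec (Dominated G u ws)
  dominated? u ws =
    map′ find (λ (_ , w∈ws , u∈N[w]) → lose w∈ws u∈N[w]) (Any.any? (inClosedNbhd? u) ws)

  Dominated-mono : ∀ {u ws ws′} → ws ⊆ ws′ → Dominated G u ws → Dominated G u ws′
  Dominated-mono ws⊆ws′ (w , w∈ws , u∈N[w]) = w , ws⊆ws′ w∈ws , u∈N[w]

  Footprint : List (Fin n) → Fin n → Set
  Footprint prev v = Σ (Fin n) λ u → InClosedNbhd G u v × ¬ Dominated G u prev

  footprint? : ∀ prev v → Dec (Footprint prev v)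
  footprint? prev v = any? (λ u → inClosedNbhd? u v ×-dec ¬? (dominated? u prev))

  ClosedNbhdSeqOfLength : List (Fin n) → ℕ → Set
  ClosedNbhdSeqOfLength prev k =
    Σ (List (Fin n)) λ vs → length vs ≡ k × ClosedNbhdSeqFrom G prev vs

  closedNbhdSeqOfLength? : ∀ prev k → Dec (ClosedNbhdSeqOfLength prev k)
  closedNbhdSeqOfLength? prev zero = yes ([] , refl , [])
  closedNbhdSeqOfLength? prev (suc k) = map′
    (λ (v , fp , vs , eq , seq) → v ∷ vs , cong suc eq , fp ∷ seq)
    (λ { (v ∷ vs , eq , fp ∷ seq) → v , fp , vs , cong pred eq , seq })
    (any? (λ v → footprint? prev v ×-dec closedNbhdSeqOfLength? (prev ∷ʳ v) k))

  ClosedNbhdSeqFrom-antitone : ∀ {prev prev′ vs} → prev′ ⊆ prev →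
    ClosedNbhdSeqFrom G prev vs → ClosedNbhdSeqFrom G prev′ vs
  ClosedNbhdSeqFrom-antitone _ [] = []
  ClosedNbhdSeqFrom-antitone prev′⊆prev ((u , u∈N[v] , undom) ∷ seq) =
    (u , u∈N[v] , λ dom → undom (Dominated-mono prev′⊆prev dom)) ∷
    ClosedNbhdSeqFrom-antitone snoc⊆snoc seq
    where
    snoc⊆snoc : ∀ {w} → w ∈ _ ∷ʳ _ → w ∈ _ ∷ʳ _
    snoc⊆snoc w∈ with ∈-++⁻ _ w∈
    ... | inj₁ w∈prev′ = ∈-++⁺ˡ (prev′⊆prev w∈prev′)
    ... | inj₂ w≡v = ∈-++⁺ʳ _ w≡v

  ClosedNbhdSeqFrom⇒All∉ : ∀ {prev vs} → ClosedNbhdSeqFrom G prev vs → All (_∉ prev) vs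
  ClosedNbhdSeqFrom⇒All∉ [] = []
  ClosedNbhdSeqFrom⇒All∉ ((u , u∈N[v] , undom) ∷ seq) =
    (λ v∈prev → undom (_ , v∈prev , u∈N[v])) ∷
    All.map (λ w∉prev∷ʳv w∈prev → w∉prev∷ʳv (∈-++⁺ˡ w∈prev)) (ClosedNbhdSeqFrom⇒All∉ seq)

  ClosedNbhdSeqFrom⇒Unique : ∀ {prev vs} → ClosedNbhdSeqFrom G prev vs → Unique vs
  ClosedNbhdSeqFrom⇒Unique [] = []
  ClosedNbhdSeqFrom⇒Unique (_ ∷ seq) =
    All.map (λ { w∉prev∷ʳv refl → w∉prev∷ʳv (∈-++⁺ʳ _ (here refl)) }) (ClosedNbhdSeqFrom⇒All∉ seq) ∷
    ClosedNbhdSeqFrom⇒Unique seq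

  closedNbhdSeq : ∀ {vs} → ClosedNbhdSeqFrom G [] vs → IsClosedNbhdSeq G vs
  closedNbhdSeq seq = ClosedNbhdSeqFrom⇒Unique seq , seq

  exchange : ∀ x {prev vs} → ClosedNbhdSeqFrom G prev vs →
    (Σ (List (Fin n)) λ vs′ → length vs′ ≡ length vs × x ∈ vs′ × ClosedNbhdSeqFrom G prev vs′)
    ⊎ ClosedNbhdSeqFrom G (x ∷ prev) vs
  exchange x [] = inj₂ []
  exchange x {prev} {v ∷ vs} ((u , u∈N[v] , undom) ∷ seq) with exchange x seq
  ... | inj₁ (vs′ , eq , x∈vs′ , seq′) =
    inj₁ (v ∷ vs′ , cong suc eq , there x∈vs′ , (u , u∈N[v] , undom) ∷ seq′)
  ... | inj₂ seqˣ with inClosedNbhd? u x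
  ...   | yes u∈N[x] =
    inj₁ (x ∷ vs , refl , here refl , (u , u∈N[x] , undom) ∷ ClosedNbhdSeqFrom-antitone swap seqˣ)
    where
    swap : prev ∷ʳ x ⊆ x ∷ (prev ∷ʳ v)
    swap w∈ with ∈-++⁻ prev w∈
    ... | inj₁ w∈prev = there (∈-++⁺ˡ w∈prev)
    ... | inj₂ (here refl) = here refl
  -- seqˣ is reused as is: (x ∷ prev) ∷ʳ v reduces to x ∷ (prev ∷ʳ v).
  ...   | no u∉N[x] = inj₂ ((u , u∈N[v] , undomˣ) ∷ seqˣ)
    where
    undomˣ : ¬ Dominated G u (x ∷ prev)
    undomˣ (_ , here refl , u∈N[x]) = u∉N[x] u∈N[x]
    undomˣ (w , there w∈prev , u∈N[w]) = undom (w , w∈prev , u∈N[w])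

  longestClosedNbhdSeq : Σ (List (Fin n)) λ vs → ClosedNbhdSeqFrom G [] vs ×
    (∀ ws → IsClosedNbhdSeq G ws → length ws ≤ length vs)
  longestClosedNbhdSeq with maximum (closedNbhdSeqOfLength? []) ([] , refl , []) n
    (λ { _ (ws , refl , seq) → Unique⇒length≤ (ClosedNbhdSeqFrom⇒Unique seq) })
  ... | _ , (vs , refl , seq) , max = vs , seq , λ ws (_ , seqʷ) → max _ (ws , refl , seqʷ)

proposition4p1 : (n : ℕ) (G : Graph n) (x : Fin n) →
    Σ (List (Fin n)) λ vs → IsGrundyDominatingSeq G vs × x ∈ vs
proposition4p1 n G x with longestClosedNbhdSeq G
... | vs , seq , longest with exchange G x seq
...   | inj₁ (vs′ , same-length , x∈vs′ , seq′) =
  vs′ , (closedNbhdSeq G seq′ , longest′) , x∈vs′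
  where
  longest′ : ∀ ws → IsClosedNbhdSeq G ws → length ws ≤ length vs′
  longest′ ws isSeq = subst (length ws ≤_) (sym same-length) (longest ws isSeq)
...   | inj₂ seqˣ = ⊥-elim (<-irrefl refl (longest (x ∷ vs) (closedNbhdSeq G x∷vs)))
  where
  x∷vs : ClosedNbhdSeqFrom G [] (x ∷ vs)
  x∷vs = (x , inj₁ refl , λ ()) ∷ seqˣ
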